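{- Let $H=(V,E)$ be a finite hypergraph. Then $H$ is perturbable if and only if $H$ does not have a perfect fractional matching.
   Context: Hypergraphs are finite, with a nonempty vertex set $V$, and each edge is a nonempty subset of $V$. A perturbation on $H=(V,E)$ is a function $p:V\to\mathbb{R}$ such that $\sum_{v\in V}p(v)=0$ and for every $e\in E$, $p(e):=\sum_{v\in e}p(v)<0$. $H$ is perturbable if a perturbation on $H$ exists. A fractional matching is a function $m:E\to[0,1]$ such that $\sum_{e\ni v}m(e)\leq 1$ for all $v\in V$; it is perfect if $\sum_{e\ni v}m(e)=1$ for all $v\in V$.
   Formalization: Perturbations take rational rather than real values, and fractional matchings take rational values between 0 and 1 rather than values in the real interval $[0,1]$. -}

module Defs where

open import Data.Nat using (ℕ; zero; suc)
open import Data.Bool using (Bool; true; false; if_then_else_)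
open import Data.Fin using (Fin; zero; suc)
open import Data.Fin.Subset using (Subset; Nonempty)
open import Data.Vec using (lookup)
open import Data.Product using (Σ; _×_; ∃)
open import Function.Definitions using (Injective)
open import Relation.Binary.PropositionalEquality using (_≡_)
open import Data.Rational using (ℚ; 0ℚ; 1ℚ; _+_; _≤_; _<_)

sumFin : (n : ℕ) → (Fin n → ℚ) → ℚ
sumFin zero    f = 0ℚ
sumFin (suc n) f = f zero + sumFin n (λ i → f (suc i))

-- A finite hypergraph: vertex set Fin n (nonempty: n = suc k),
-- edge set indexed by Fin m, edges pairwise distinct and nonempty.
record Hypergraph : Set where
  field
    nV     : ℕ
    nE     : ℕ
    edge   : Fin nE → Subset (suc nV)
    edgeNonempty : (e : Fin nE) → Nonempty (edge e)
    edgeDistinct : Injective _≡_ _≡_ edge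

  V : ℕ
  V = suc nV

open Hypergraph public

sumOver : {n : ℕ} → Subset n → (Fin n → ℚ) → ℚ
sumOver {n} s p = sumFin n (λ v → if lookup s v then p v else 0ℚ)

IsPerturbation : (H : Hypergraph) → (Fin (V H) → ℚ) → Set
IsPerturbation H p =
  (sumFin (V H) p ≡ 0ℚ) × ((e : Fin (nE H)) → sumOver (edge H e) p < 0ℚ)

Perturbable : Hypergraph → Set
Perturbable H = Σ (Fin (V H) → ℚ) (IsPerturbation H)

load : (H : Hypergraph) → (Fin (nE H) → ℚ) → Fin (V H) → ℚ
load H m v = sumFin (nE H) (λ e → if lookup (edge H e) v then m e else 0ℚ)

IsFractionalMatching : (H : Hypergraph) → (Fin (nE H) → ℚ) → Set
IsFractionalMatching H m =
  ((e : Fin (nE H)) → (0ℚ ≤ m e) × (m e ≤ 1ℚ)) ×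
  ((v : Fin (V H)) → load H m v ≤ 1ℚ)

IsPerfectFractionalMatching : (H : Hypergraph) → (Fin (nE H) → ℚ) → Set
IsPerfectFractionalMatching H m =
  IsFractionalMatching H m × ((v : Fin (V H)) → load H m v ≡ 1ℚ)

HasPerfectFractionalMatching : Hypergraph → Set
HasPerfectFractionalMatching H = Σ (Fin (nE H) → ℚ) (IsPerfectFractionalMatching H)

-- A perturbation is a solution of the strict system p(e) < 0 (e ∈ E) on the hyperplane Σ p = 0.
-- Eliminating p(0) = - Σ_{v ≠ 0} p(v) turns it into a homogeneous strict system A q < 0, whose
-- rows are A_e(k) = [k+1 ∈ e] - [0 ∈ e]. By Gordan's alternative, which follows by Fourier–Motzkin
-- elimination, either A q < 0 is solvable or some nonnegative, nonzero weighting w of the rows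
-- satisfies Σ_e w_e A_e = 0, and not both. The latter says that the load of w is the same positive
-- number at every vertex, so rescaling w gives a perfect fractional matching; conversely a perfect
-- fractional matching is such a weighting.
module Submission where

open import Defs

open import Algebra.Bundles using (CommutativeRing)
open import Data.Bool using (Bool; true; false; if_then_else_)
open import Data.Empty using (⊥; ⊥-elim)
open import Data.Fin using (Fin; zero; suc)
import Data.Fin.Subset as Subset
open import Data.List using (List; []; _∷_; _++_; map; filter; cartesianProductWith; allFin; length)
import Data.List as List
open import Data.List.Membership.Propositional using (_∈_)
open import Data.List.Membership.Propositional.Properties
  using (∈-++⁺ˡ; ∈-++⁺ʳ; ∈-++⁻; ∈-map⁺; ∈-map⁻; ∈-filter⁺; ∈-filter⁻;
         ∈-cartesianProductWith⁺; ∈-cartesianProductWith⁻; ∈-allFin; ∈-lookup)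
import Data.List.Relation.Unary.All as All
open import Data.List.Relation.Unary.Any using (here; there; index)
open import Data.List.Relation.Unary.Any.Properties using (lookup-index)
open import Data.Nat using (ℕ; zero; suc)
open import Data.Product using (_×_; _,_; proj₁; proj₂; ∃-syntax)
open import Data.Rational
  using (ℚ; 0ℚ; 1ℚ; _+_; _*_; -_; _-_; _÷_; 1/_; _≤_; _<_; _≟_; _<?_;
         ≢-nonZero; NonZero; positive; negative; nonNegative; nonPositive)
open import Data.Rational.Properties
open import Data.Rational.Solver using (module +-*-Solver)
open import Data.Sum using (_⊎_; inj₁; inj₂; [_,_]′)
import Data.Sum as Sum
open import Data.Vec using (lookup)
open import Data.Vec.Functional using (Vector; head; tail)
import Data.Vec.Functional as Vec
open import Data.Vec.Properties using ([]=⇒lookup)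
open import Function using (_∘_; id)
open import Function.Bundles using (_⇔_; mk⇔)
open import Relation.Binary.Bundles using (DecTotalOrder)
open import Relation.Binary.Definitions using (tri<; tri≈; tri>)
open import Relation.Binary.PropositionalEquality
open import Relation.Nullary using (¬_; Dec; yes; no; contradiction)

open import Algebra.Properties.Semiring.Sum (CommutativeRing.semiring +-*-commutativeRing)
  using (sum; sum-syntax; sum-cong-≗; sum-replicate-zero; ∑-distrib-+; ∑-comm; *-distribˡ-sum; *-distribʳ-sum)
open import Algebra.Properties.Group +-0-group using () renaming (x∙y⁻¹≈ε⇒x≈y to p-q≡0⇒p≡q)
open import Data.List.Extrema (DecTotalOrder.totalOrder ≤-decTotalOrder)
  using (min; max; argmin-sel; argmax-sel; min≤⊤; min≤xs; xs≤max)

private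
  variable
    l m n : ℕ

≥0*≥0⇒≥0 : ∀ {p q} → 0ℚ ≤ p → 0ℚ ≤ q → 0ℚ ≤ p * q
≥0*≥0⇒≥0 {p} {q} p≥0 q≥0 =
  nonNegative⁻¹ _ {{nonNeg*nonNeg⇒nonNeg p {{nonNegative p≥0}} q {{nonNegative q≥0}}}}

>0*>0⇒>0 : ∀ {p q} → 0ℚ < p → 0ℚ < q → 0ℚ < p * q
>0*>0⇒>0 {p} {q} p>0 q>0 =
  positive⁻¹ _ {{pos*pos⇒pos p {{positive p>0}} q {{positive q>0}}}}

≥0*<0⇒≤0 : ∀ {p q} → 0ℚ ≤ p → q < 0ℚ → p * q ≤ 0ℚ
≥0*<0⇒≤0 {p} {q} p≥0 q<0 =
  nonPositive⁻¹ _ {{nonNeg*nonPos⇒nonPos p {{nonNegative p≥0}} q {{nonPositive (<⇒≤ q<0)}}}}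

>0*<0⇒<0 : ∀ {p q} → 0ℚ < p → q < 0ℚ → p * q < 0ℚ
>0*<0⇒<0 {p} {q} p>0 q<0 =
  negative⁻¹ _ {{pos*neg⇒neg p {{positive p>0}} q {{negative q<0}}}}

p<p+1 : ∀ p → p < p + 1ℚ
p<p+1 p = <-respˡ-≡ (+-identityʳ p) (+-monoʳ-< p (positive⁻¹ 1ℚ))

p-1<p : ∀ p → p - 1ℚ < p
p-1<p p = <-respʳ-≡ (solve 1 (λ p → p :- con 1ℚ :+ con 1ℚ := p) refl p) (p<p+1 (p - 1ℚ))
  where open +-*-Solver

p-q<0⇒p<q : ∀ {p q} → p - q < 0ℚ → p < q
p-q<0⇒p<q {p} {q} p-q<0 =
  <-respˡ-≡ (solve 2 (λ p q → p :- q :+ q := p) refl p q) (<-respʳ-≡ (+-identityˡ q) (+-monoˡ-< q p-q<0))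
  where open +-*-Solver

p<-d⇒p+d<0 : ∀ {p d} → p < - d → p + d < 0ℚ
p<-d⇒p+d<0 {p} {d} p<-d = <-respʳ-≡ (+-inverseˡ d) (+-monoˡ-< d p<-d)

Row : ℕ → Set
Row = Vector ℚ

∑-mono-≤ : {f g : Row n} → (∀ i → f i ≤ g i) → sum f ≤ sum g
∑-mono-≤ {zero}  _   = ≤-refl
∑-mono-≤ {suc n} f≤g = +-mono-≤ (f≤g zero) (∑-mono-≤ (f≤g ∘ suc))

∑-mono-< : {f g : Row n} → (∀ i → f i ≤ g i) → ∀ j → f j < g j → sum f < sum g
∑-mono-< {suc n} f≤g zero    fj<gj = +-mono-<-≤ fj<gj (∑-mono-≤ (f≤g ∘ suc))
∑-mono-< {suc n} f≤g (suc j) fj<gj = +-mono-≤-< (f≤g zero) (∑-mono-< (f≤g ∘ suc) j fj<gj)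

∑-nonneg : {f : Row n} → (∀ i → 0ℚ ≤ f i) → 0ℚ ≤ sum f
∑-nonneg {n} f≥0 = ≤-trans (≤-reflexive (sym (sum-replicate-zero n))) (∑-mono-≤ f≥0)

∑-positive : {f : Row n} → (∀ i → 0ℚ ≤ f i) → ∀ j → 0ℚ < f j → 0ℚ < sum f
∑-positive {n} f≥0 j fj>0 = <-respˡ-≡ (sum-replicate-zero n) (∑-mono-< f≥0 j fj>0)

∑-negative : {f : Row n} → (∀ i → f i ≤ 0ℚ) → ∀ j → f j < 0ℚ → sum f < 0ℚ
∑-negative {n} f≤0 j fj<0 = <-respʳ-≡ (sum-replicate-zero n) (∑-mono-< f≤0 j fj<0)

term≤∑ : {f : Row n} → (∀ i → 0ℚ ≤ f i) → ∀ j → f j ≤ sum f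
term≤∑ {suc n} {f} f≥0 zero =
  ≤-trans (≤-reflexive (sym (+-identityʳ (f zero)))) (+-monoʳ-≤ (f zero) (∑-nonneg (f≥0 ∘ suc)))
term≤∑ {suc n} {f} f≥0 (suc j) =
  ≤-trans (≤-reflexive (sym (+-identityˡ (f (suc j))))) (+-mono-≤ (f≥0 zero) (term≤∑ (f≥0 ∘ suc) j))

∃-positive-term : (f : Row n) → 0ℚ < sum f → ∃[ i ] 0ℚ < f i
∃-positive-term {zero}  f 0<0  = contradiction 0<0 (<-irrefl refl)
∃-positive-term {suc n} f 0<∑f with 0ℚ <? f zero
... | yes f₀>0 = zero , f₀>0
... | no  f₀≯0 = let i , fi>0 = ∃-positive-term (tail f) (≰⇒> ∑tail≰0) in suc i , fi>0
  where
  ∑tail≰0 : ¬ sum (tail f) ≤ 0ℚ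
  ∑tail≰0 ∑tail≤0 = <-irrefl refl (<-≤-trans 0<∑f (+-mono-≤ (≮⇒≥ f₀≯0) ∑tail≤0))

∑-neg : (f : Row n) → ∑[ i < n ] (- f i) ≡ - sum f
∑-neg {zero}  f = refl
∑-neg {suc n} f = trans (cong (- f zero +_) (∑-neg (tail f))) (sym (neg-distrib-+ (f zero) (sum (tail f))))

∑-distrib-- : (f g : Row n) → ∑[ i < n ] (f i - g i) ≡ sum f - sum g
∑-distrib-- f g = trans (∑-distrib-+ f (λ i → - g i)) (cong (sum f +_) (∑-neg g))

infix 7 _·_

_·_ : Row n → Row n → ℚ
u · x = ∑[ k < _ ] (u k * x k)

·-zeroˡ : {u : Row n} (x : Row n) → (∀ k → u k ≡ 0ℚ) → u · x ≡ 0ℚ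
·-zeroˡ {n} x u≡0 =
  trans (sum-cong-≗ (λ k → trans (cong (_* x k) (u≡0 k)) (*-zeroˡ (x k)))) (sum-replicate-zero n)

·-zeroʳ : (u : Row n) {x : Row n} → (∀ k → x k ≡ 0ℚ) → u · x ≡ 0ℚ
·-zeroʳ {n} u x≡0 =
  trans (sum-cong-≗ (λ k → trans (cong (u k *_) (x≡0 k)) (*-zeroʳ (u k)))) (sum-replicate-zero n)

combination : (Fin m → Row n) → Row m → Row n
combination a w k = w · (λ i → a i k)

combination-· : (a : Fin m → Row n) (w : Row m) (x : Row n) →
                combination a w · x ≡ w · (λ i → a i · x)
combination-· {m} {n} a w x = begin
  ∑[ k < n ] (∑[ i < m ] (w i * a i k) * x k)
    ≡⟨ sum-cong-≗ (λ k → *-distribʳ-sum (x k) (λ i → w i * a i k)) ⟩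
  ∑[ k < n ] ∑[ i < m ] (w i * a i k * x k)
    ≡⟨ ∑-comm (λ k i → w i * a i k * x k) ⟩
  ∑[ i < m ] ∑[ k < n ] (w i * a i k * x k)
    ≡⟨ sum-cong-≗ (λ i → sum-cong-≗ (λ k → *-assoc (w i) (a i k) (x k))) ⟩
  ∑[ i < m ] ∑[ k < n ] (w i * (a i k * x k))
    ≡⟨ sum-cong-≗ (λ i → sym (*-distribˡ-sum (w i) (λ k → a i k * x k))) ⟩
  ∑[ i < m ] (w i * (a i · x))
    ∎
  where open ≡-Reasoning

combination-*ʳ : (a : Fin m → Row n) (w : Row m) (r : ℚ) (k : Fin n) →
                 combination a (λ i → w i * r) k ≡ combination a w k * r
combination-*ʳ a w r k = trans
  (sum-cong-≗ (λ i → solve 3 (λ x y z → x :* y :* z := x :* z :* y) refl (w i) r (a i k)))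
  (sym (*-distribʳ-sum r (λ i → w i * a i k)))
  where open +-*-Solver

δ : Fin m → Row m
δ zero    zero    = 1ℚ
δ zero    (suc _) = 0ℚ
δ (suc _) zero    = 0ℚ
δ (suc j) (suc i) = δ j i

δ-diag : (j : Fin m) → δ j j ≡ 1ℚ
δ-diag zero    = refl
δ-diag (suc j) = δ-diag j

δ-nonneg : (j i : Fin m) → 0ℚ ≤ δ j i
δ-nonneg zero    zero    = nonNegative⁻¹ 1ℚ
δ-nonneg zero    (suc _) = ≤-refl
δ-nonneg (suc _) zero    = ≤-refl
δ-nonneg (suc j) (suc i) = δ-nonneg j i

δ-· : (j : Fin m) (f : Row m) → δ j · f ≡ f j
δ-· {suc m} zero f = begin
  1ℚ * f zero + tail (δ zero) · tail f  ≡⟨ cong₂ _+_ (*-identityˡ (f zero)) (·-zeroˡ (tail f) (λ _ → refl)) ⟩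
  f zero + 0ℚ                           ≡⟨ +-identityʳ (f zero) ⟩
  f zero                                ∎
  where open ≡-Reasoning
δ-· {suc m} (suc j) f = begin
  0ℚ * f zero + δ j · tail f  ≡⟨ cong₂ _+_ (*-zeroˡ (f zero)) (δ-· j (tail f)) ⟩
  0ℚ + f (suc j)              ≡⟨ +-identityˡ (f (suc j)) ⟩
  f (suc j)                   ∎
  where open ≡-Reasoning

Semipositive : Row m → Set
Semipositive w = (∀ i → 0ℚ ≤ w i) × ∃[ i ] 0ℚ < w i

Solution : (Fin m → Row n) → Set
Solution a = ∃[ x ] ∀ i → a i · x < 0ℚ

Certificate : (Fin m → Row n) → Set
Certificate a = ∃[ w ] Semipositive w × (∀ k → combination a w k ≡ 0ℚ)

δ-semipositive : (j : Fin m) → Semipositive (δ j)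
δ-semipositive j = δ-nonneg j , j , <-respʳ-≡ (sym (δ-diag j)) (positive⁻¹ 1ℚ)

semipositive-combination : (g : Fin l → Row m) → (∀ k → Semipositive (g k)) →
                           {w : Row l} → Semipositive w → Semipositive (combination g w)
semipositive-combination g g⁺ {w} (w≥0 , k , wk>0) = let i , gki>0 = proj₂ (g⁺ k) in
  (λ j → ∑-nonneg (terms≥0 j)) , i , ∑-positive (terms≥0 i) k (>0*>0⇒>0 wk>0 gki>0)
  where
  terms≥0 : ∀ j k → 0ℚ ≤ w k * g k j
  terms≥0 j k = ≥0*≥0⇒≥0 (w≥0 k) (proj₁ (g⁺ k) j)

semipositive-·-negative : {w f : Row m} → Semipositive w → (∀ i → f i < 0ℚ) → w · f < 0ℚ
semipositive-·-negative (w≥0 , i , wi>0) f<0 =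
  ∑-negative (λ j → ≥0*<0⇒≤0 (w≥0 j) (f<0 j)) i (>0*<0⇒<0 wi>0 (f<0 i))

solution-certificate-exclusive : (a : Fin m → Row n) → Solution a → Certificate a → ⊥
solution-certificate-exclusive a (x , ax<0) (w , w⁺ , aw≡0) =
  <-irrefl w·ax≡0 (semipositive-·-negative w⁺ ax<0)
  where
  w·ax≡0 : w · (λ i → a i · x) ≡ 0ℚ
  w·ax≡0 = trans (sym (combination-· a w x)) (·-zeroˡ x aw≡0)

certificate-pullback : (a : Fin m → Row n) (g : Fin l → Row m) → (∀ k → Semipositive (g k)) →
                       Certificate (combination a ∘ g) → Certificate a
certificate-pullback a g g⁺ (w , w⁺ , agw≡0) =
  combination g w , semipositive-combination g g⁺ w⁺ ,
  λ k → trans (combination-· g w (λ i → a i k)) (agw≡0 k)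

certificate-∷ : (a : Fin m → Row (suc n)) → (∀ i → head (a i) ≡ 0ℚ) →
                Certificate (tail ∘ a) → Certificate a
certificate-∷ a a₀≡0 (w , w⁺ , aw≡0) = w , w⁺ , λ where
  zero    → ·-zeroʳ w a₀≡0
  (suc k) → aw≡0 k

interval : (L U : List ℚ) → (∀ {l u} → l ∈ L → u ∈ U → l < u) →
           ∃[ x ] (∀ {l} → l ∈ L → l < x) × (∀ {u} → u ∈ U → x < u)
interval L [] _ = max 0ℚ L + 1ℚ , (λ l∈L → ≤-<-trans (All.lookup (xs≤max 0ℚ L) l∈L) (p<p+1 _)) , λ ()
interval L (u ∷ U) L<U = let x , lo<x , x<hi = <-dense lo<hi in
  x , (λ l∈L → ≤-<-trans (All.lookup (xs≤max (hi - 1ℚ) L) l∈L) lo<x) ,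
  (λ v∈ → <-≤-trans x<hi (hi≤ v∈))
  where
  hi : ℚ
  hi = min u U
  hi∈ : hi ∈ u ∷ U
  hi∈ = [ here , there ]′ (argmin-sel id u U)
  hi≤ : ∀ {v} → v ∈ u ∷ U → hi ≤ v
  hi≤ (here refl)  = min≤⊤ u U
  hi≤ (there v∈U) = All.lookup (min≤xs u U) v∈U
  lo : ℚ
  lo = max (hi - 1ℚ) L
  lo<hi : lo < hi
  lo<hi = [ (λ lo≡ → <-respˡ-≡ (sym lo≡) (p-1<p hi)) , (λ lo∈L → L<U lo∈L hi∈) ]′
            (argmax-sel id (hi - 1ℚ) L)

-- The zero of x ↦ c * x + d; the value 0 returned for c = 0 is junk.
root : ℚ → ℚ → ℚ
root c d with c ≟ 0ℚ
... | yes _  = 0ℚ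
... | no c≢0 = (- d ÷ c) {{≢-nonZero c≢0}}

*-root : ∀ {c} d → c ≢ 0ℚ → c * root c d ≡ - d
*-root {c} d c≢0 with c ≟ 0ℚ
... | yes c≡0 = contradiction c≡0 c≢0
... | no c≢0 = begin
  c * (- d * 1/c)   ≡⟨ solve 3 (λ c d e → c :* (:- d :* e) := :- d :* (c :* e)) refl c d 1/c ⟩
  - d * (c * 1/c)   ≡⟨ cong (- d *_) (*-inverseʳ c {{≢-nonZero c≢0}}) ⟩
  - d * 1ℚ          ≡⟨ *-identityʳ (- d) ⟩
  - d               ∎
  where
  open ≡-Reasoning
  open +-*-Solver
  1/c = (1/ c) {{≢-nonZero c≢0}}

below-root : ∀ {c d x} → 0ℚ < c → x < root c d → c * x + d < 0ℚ
below-root {c} {d} c>0 x<r =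
  p<-d⇒p+d<0 (<-respʳ-≡ (*-root d (λ c≡0 → <⇒≢ c>0 (sym c≡0))) (*-monoʳ-<-pos c {{positive c>0}} x<r))

above-root : ∀ {c d x} → c < 0ℚ → root c d < x → c * x + d < 0ℚ
above-root {c} {d} c<0 r<x =
  p<-d⇒p+d<0 (<-respʳ-≡ (*-root d (<⇒≢ c<0)) (*-monoʳ-<-neg c {{negative c<0}} r<x))

root-< : ∀ {c c′ d d′} → 0ℚ < c → c′ < 0ℚ → c * d′ < c′ * d → root c′ d′ < root c d
root-< {c} {c′} {d} {d′} c>0 c′<0 cd′<c′d = *-cancelˡ-<-nonNeg k {{nonNegative (<⇒≤ k>0)}} (begin-strict
  k * r′            ≡⟨ solve 3 (λ c c′ r′ → c :* :- c′ :* r′ := :- c :* (c′ :* r′)) refl c c′ r′ ⟩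
  - c * (c′ * r′)   ≡⟨ cong (- c *_) (*-root d′ (<⇒≢ c′<0)) ⟩
  - c * - d′        ≡⟨ solve 2 (λ c d′ → :- c :* :- d′ := c :* d′) refl c d′ ⟩
  c * d′            <⟨ cd′<c′d ⟩
  c′ * d            ≡⟨ solve 2 (λ c′ d → c′ :* d := :- c′ :* :- d) refl c′ d ⟩
  - c′ * - d        ≡⟨ cong (- c′ *_) (*-root d (λ c≡0 → <⇒≢ c>0 (sym c≡0))) ⟨
  - c′ * (c * r)    ≡⟨ solve 3 (λ c c′ r → :- c′ :* (c :* r) := c :* :- c′ :* r) refl c c′ r ⟩
  k * r             ∎)
  where
  open ≤-Reasoning
  open +-*-Solver
  k r r′ : ℚ
  k = c * - c′
  r = root c d
  r′ = root c′ d′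
  k>0 : 0ℚ < k
  k>0 = >0*>0⇒>0 c>0 (neg-antimono-< c′<0)

affine-separation : (c d : Row m) → (∀ i → c i ≡ 0ℚ → d i < 0ℚ) →
                    (∀ p q → 0ℚ < c p → c q < 0ℚ → c p * d q < c q * d p) →
                    ∃[ x ] ∀ i → c i * x + d i < 0ℚ
affine-separation {m} c d d<0 compatible = x , c*x+d<0
  where
  r : Fin m → ℚ
  r i = root (c i) (d i)
  rising? : (i : Fin m) → Dec (0ℚ < c i)
  rising? i = 0ℚ <? c i
  falling? : (i : Fin m) → Dec (c i < 0ℚ)
  falling? i = c i <? 0ℚ
  lower upper : List ℚ
  lower = map r (filter falling? (allFin m))
  upper = map r (filter rising? (allFin m))
  lower<upper : ∀ {l u} → l ∈ lower → u ∈ upper → l < u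
  lower<upper l∈ u∈ with ∈-map⁻ r l∈ | ∈-map⁻ r u∈
  ... | q , q∈ , refl | p , p∈ , refl = root-< cp>0 cq<0 (compatible p q cp>0 cq<0)
    where
    cp>0 : 0ℚ < c p
    cp>0 = proj₂ (∈-filter⁻ rising? {xs = allFin m} p∈)
    cq<0 : c q < 0ℚ
    cq<0 = proj₂ (∈-filter⁻ falling? {xs = allFin m} q∈)
  separated : ∃[ x ] (∀ {l} → l ∈ lower → l < x) × (∀ {u} → u ∈ upper → x < u)
  separated = interval lower upper lower<upper
  x : ℚ
  x = proj₁ separated
  c*x+d<0 : ∀ i → c i * x + d i < 0ℚ
  c*x+d<0 i with <-cmp (c i) 0ℚ
  ... | tri< ci<0 _ _ =
    above-root ci<0 (proj₁ (proj₂ separated) (∈-map⁺ r (∈-filter⁺ falling? (∈-allFin i) ci<0)))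
  ... | tri> _ _ ci>0 =
    below-root ci>0 (proj₂ (proj₂ separated) (∈-map⁺ r (∈-filter⁺ rising? (∈-allFin i) ci>0)))
  ... | tri≈ _ ci≡0 _ = <-respˡ-≡ (sym c*x+d≡d) (d<0 i ci≡0)
    where
    c*x+d≡d : c i * x + d i ≡ d i
    c*x+d≡d = trans (cong (λ t → t * x + d i) ci≡0) (trans (cong (_+ d i) (*-zeroˡ x)) (+-identityˡ (d i)))

-- Fourier–Motzkin elimination of the first coordinate. Every eliminated row is a semipositive
-- combination of the rows of a whose first entry vanishes, so certificates pull back; a solution y
-- of the eliminated system leaves one-variable constraints c i * x + d i < 0 which the eliminated
-- rows make pairwise compatible, so y extends to a solution of a.
module Elimination {m n} (a : Fin m → Row (suc n)) where

  c : Row m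
  c i = head (a i)

  b : Fin m → Row n
  b i = tail (a i)

  cancelling : Fin m → Fin m → Row m
  cancelling p q i = c p * δ q i - c q * δ p i

  cancelling-· : ∀ p q (f : Row m) → cancelling p q · f ≡ c p * f q - c q * f p
  cancelling-· p q f = begin
    ∑[ i < m ] ((c p * δ q i - c q * δ p i) * f i)
      ≡⟨ sum-cong-≗ (λ i → solve 5 (λ α β x y z → (α :* x :- β :* y) :* z
                                                  := α :* (x :* z) :+ :- β :* (y :* z))
                                   refl (c p) (c q) (δ q i) (δ p i) (f i)) ⟩
    ∑[ i < m ] (c p * (δ q i * f i) + - c q * (δ p i * f i))
      ≡⟨ ∑-distrib-+ (λ i → c p * (δ q i * f i)) (λ i → - c q * (δ p i * f i)) ⟩
    ∑[ i < m ] (c p * (δ q i * f i)) + ∑[ i < m ] (- c q * (δ p i * f i))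
      ≡⟨ cong₂ _+_ (*-distribˡ-sum (c p) (λ i → δ q i * f i))
                   (*-distribˡ-sum (- c q) (λ i → δ p i * f i)) ⟨
    c p * (δ q · f) + - c q * (δ p · f)
      ≡⟨ cong₂ (λ s t → c p * s + - c q * t) (δ-· q f) (δ-· p f) ⟩
    c p * f q + - c q * f p
      ≡⟨ cong (c p * f q +_) (neg-distribˡ-* (c q) (f p)) ⟨
    c p * f q - c q * f p ∎
    where
    open ≡-Reasoning
    open +-*-Solver

  data Coefficient : Row m → Set where
    unit   : ∀ {i} → c i ≡ 0ℚ → Coefficient (δ i)
    cancel : ∀ {p q} → 0ℚ < c p → c q < 0ℚ → Coefficient (cancelling p q)

  coefficient-semipositive : ∀ {γ} → Coefficient γ → Semipositive γ
  coefficient-semipositive (unit {i} _) = δ-semipositive i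
  coefficient-semipositive (cancel {p} {q} cp>0 cq<0) = γ≥0 , q , γq>0
    where
    -cqδ≥0 : ∀ i → 0ℚ ≤ - (c q * δ p i)
    -cqδ≥0 i = ≤-trans (≥0*≥0⇒≥0 (<⇒≤ (neg-antimono-< cq<0)) (δ-nonneg p i))
                       (≤-reflexive (sym (neg-distribˡ-* (c q) (δ p i))))
    γ≥0 : ∀ i → 0ℚ ≤ cancelling p q i
    γ≥0 i = +-mono-≤ (≥0*≥0⇒≥0 (<⇒≤ cp>0) (δ-nonneg q i)) (-cqδ≥0 i)
    γq>0 : 0ℚ < cancelling p q q
    γq>0 = +-mono-<-≤ (<-respʳ-≡ (trans (sym (*-identityʳ (c p))) (cong (c p *_) (sym (δ-diag q)))) cp>0)
                      (-cqδ≥0 q)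

  coefficient-·-c : ∀ {γ} → Coefficient γ → γ · c ≡ 0ℚ
  coefficient-·-c (unit {i} ci≡0) = trans (δ-· i c) ci≡0
  coefficient-·-c (cancel {p} {q} _ _) =
    trans (cancelling-· p q c) (solve 2 (λ x y → x :* y :- y :* x := con 0ℚ) refl (c p) (c q))
    where open +-*-Solver

  level? : (i : Fin m) → Dec (c i ≡ 0ℚ)
  level? i = c i ≟ 0ℚ
  rising? : (i : Fin m) → Dec (0ℚ < c i)
  rising? i = 0ℚ <? c i
  falling? : (i : Fin m) → Dec (c i < 0ℚ)
  falling? i = c i <? 0ℚ

  coefficients : List (Row m)
  coefficients = map δ (filter level? (allFin m))
              ++ cartesianProductWith cancelling (filter rising? (allFin m)) (filter falling? (allFin m))

  coefficient⁻ : ∀ {γ} → γ ∈ coefficients → Coefficient γ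
  coefficient⁻ γ∈ with ∈-++⁻ (map δ (filter level? (allFin m))) γ∈
  ... | inj₁ γ∈units with ∈-map⁻ δ γ∈units
  ...   | i , i∈ , refl = unit (proj₂ (∈-filter⁻ level? {xs = allFin m} i∈))
  coefficient⁻ γ∈ | inj₂ γ∈pairs
    with ∈-cartesianProductWith⁻ cancelling (filter rising? (allFin m)) (filter falling? (allFin m)) γ∈pairs
  ...   | p , q , p∈ , q∈ , refl =
    cancel (proj₂ (∈-filter⁻ rising? {xs = allFin m} p∈)) (proj₂ (∈-filter⁻ falling? {xs = allFin m} q∈))

  δ∈coefficients : ∀ {i} → c i ≡ 0ℚ → δ i ∈ coefficients
  δ∈coefficients {i} ci≡0 = ∈-++⁺ˡ (∈-map⁺ δ (∈-filter⁺ level? (∈-allFin i) ci≡0))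

  cancelling∈coefficients : ∀ {p q} → 0ℚ < c p → c q < 0ℚ → cancelling p q ∈ coefficients
  cancelling∈coefficients {p} {q} cp>0 cq<0 = ∈-++⁺ʳ (map δ (filter level? (allFin m)))
    (∈-cartesianProductWith⁺ cancelling (∈-filter⁺ rising? (∈-allFin p) cp>0)
                                        (∈-filter⁺ falling? (∈-allFin q) cq<0))

  eliminated : Fin (length coefficients) → Row n
  eliminated k = combination b (List.lookup coefficients k)

  certificate : Certificate eliminated → Certificate a
  certificate =
      certificate-pullback a (List.lookup coefficients) (coefficient-semipositive ∘ coefficient⁻ ∘ ∈-lookup)
    ∘ certificate-∷ (combination a ∘ List.lookup coefficients) (coefficient-·-c ∘ coefficient⁻ ∘ ∈-lookup)

  solution : Solution eliminated → Solution a
  solution (y , ey<0) = proj₁ separated Vec.∷ y , proj₂ separated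
    where
    d : Row m
    d i = b i · y
    ·d<0 : ∀ {γ} → γ ∈ coefficients → γ · d < 0ℚ
    ·d<0 {γ} γ∈ = <-respˡ-≡
      (trans (cong (λ γ → combination b γ · y) (sym (lookup-index γ∈))) (combination-· b γ y))
      (ey<0 (index γ∈))
    separated : ∃[ x ] ∀ i → c i * x + d i < 0ℚ
    separated = affine-separation c d
      (λ i ci≡0 → <-respˡ-≡ (δ-· i d) (·d<0 (δ∈coefficients ci≡0)))
      (λ p q cp>0 cq<0 → p-q<0⇒p<q (<-respˡ-≡ (cancelling-· p q d) (·d<0 (cancelling∈coefficients cp>0 cq<0))))

gordan : ∀ n {m} (a : Fin m → Row n) → Solution a ⊎ Certificate a
gordan zero    {zero}  a = inj₁ ((λ ()) , λ ())
gordan zero    {suc m} a = inj₂ ((λ _ → 1ℚ) , ((λ _ → nonNegative⁻¹ 1ℚ) , zero , positive⁻¹ 1ℚ) , λ ())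
gordan (suc n)         a = Sum.map solution certificate (gordan n eliminated)
  where open Elimination a

restrict : Row (suc n) → Row n
restrict u k = u (suc k) - u zero

restrict-· : (u p : Row (suc n)) → restrict u · tail p ≡ u · p - head u * sum p
restrict-· {n} u p = begin
  ∑[ k < n ] ((u (suc k) - u zero) * p (suc k))
    ≡⟨ sum-cong-≗ (λ k → solve 3 (λ x y z → (x :- y) :* z := x :* z :- y :* z)
                                 refl (u (suc k)) (u zero) (p (suc k))) ⟩
  ∑[ k < n ] (u (suc k) * p (suc k) - u zero * p (suc k))
    ≡⟨ ∑-distrib-- (λ k → u (suc k) * p (suc k)) (λ k → u zero * p (suc k)) ⟩
  tail u · tail p - ∑[ k < n ] (u zero * p (suc k))
    ≡⟨ cong (_-_ (tail u · tail p)) (*-distribˡ-sum (u zero) (tail p)) ⟨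
  tail u · tail p - u zero * sum (tail p)
    ≡⟨ solve 4 (λ u₀ p₀ s t → s :- u₀ :* t := (u₀ :* p₀ :+ s) :- u₀ :* (p₀ :+ t))
               refl (u zero) (p zero) (tail u · tail p) (sum (tail p)) ⟩
  u · p - head u * sum p
    ∎
  where
  open ≡-Reasoning
  open +-*-Solver

restrict-·-sum≡0 : (u p : Row (suc n)) → sum p ≡ 0ℚ → restrict u · tail p ≡ u · p
restrict-·-sum≡0 u p ∑p≡0 = begin
  restrict u · tail p        ≡⟨ restrict-· u p ⟩
  u · p - head u * sum p     ≡⟨ cong (λ s → u · p - head u * s) ∑p≡0 ⟩
  u · p - head u * 0ℚ        ≡⟨ solve 2 (λ x y → x :- y :* con 0ℚ := x) refl (u · p) (head u) ⟩
  u · p                      ∎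
  where
  open ≡-Reasoning
  open +-*-Solver

restrict-combination : (a : Fin m → Row (suc n)) (w : Row m) (k : Fin n) →
                       combination (restrict ∘ a) w k ≡ combination a w (suc k) - combination a w zero
restrict-combination {m} a w k = trans
  (sum-cong-≗ (λ i → solve 3 (λ x y z → x :* (y :- z) := x :* y :- x :* z) refl (w i) (a i (suc k)) (a i zero)))
  (∑-distrib-- (λ i → w i * a i (suc k)) (λ i → w i * a i zero))
  where open +-*-Solver

sumFin≡∑ : ∀ n (f : Row n) → sumFin n f ≡ sum f
sumFin≡∑ zero    f = refl
sumFin≡∑ (suc n) f = cong (f zero +_) (sumFin≡∑ n (tail f))

indicator : Bool → ℚ
indicator b = if b then 1ℚ else 0ℚ

indicator-nonneg : ∀ b → 0ℚ ≤ indicator b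
indicator-nonneg true  = nonNegative⁻¹ 1ℚ
indicator-nonneg false = ≤-refl

indicator-* : ∀ b x → indicator b * x ≡ (if b then x else 0ℚ)
indicator-* true  x = *-identityˡ x
indicator-* false x = *-zeroˡ x

*-indicator : ∀ x b → x * indicator b ≡ (if b then x else 0ℚ)
*-indicator x b = trans (*-comm x (indicator b)) (indicator-* b x)

module _ (H : Hypergraph) where

  incidence : Fin (nE H) → Row (V H)
  incidence e v = indicator (lookup (edge H e) v)

  sumOver≡incidence-· : ∀ e p → sumOver (edge H e) p ≡ incidence e · p
  sumOver≡incidence-· e p = trans (sumFin≡∑ (V H) (λ v → if lookup (edge H e) v then p v else 0ℚ))
                                  (sum-cong-≗ (λ v → sym (indicator-* (lookup (edge H e) v) (p v))))

  load≡combination : ∀ m v → load H m v ≡ combination incidence m v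
  load≡combination m v = trans (sumFin≡∑ (nE H) (λ e → if lookup (edge H e) v then m e else 0ℚ))
                               (sum-cong-≗ (λ e → sym (*-indicator (m e) (lookup (edge H e) v))))

  term≤load : ∀ {m} → (∀ e → 0ℚ ≤ m e) →
              ∀ {e v} → v Subset.∈ edge H e → m e ≤ combination incidence m v
  term≤load {m} m≥0 {e} {v} v∈e = ≤-trans
    (≤-reflexive (trans (sym (*-identityʳ (m e))) (cong (λ b → m e * indicator b) (sym ([]=⇒lookup v∈e)))))
    (term≤∑ (λ e′ → ≥0*≥0⇒≥0 (m≥0 e′) (indicator-nonneg (lookup (edge H e′) v))) e)

  perfect-fractional-matching : ∀ {m} → (∀ e → 0ℚ ≤ m e) → (∀ v → load H m v ≡ 1ℚ) →
                                IsPerfectFractionalMatching H m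
  perfect-fractional-matching {m} m≥0 load≡1 =
    ((λ e → m≥0 e , m≤1 e) , λ v → ≤-reflexive (load≡1 v)) , load≡1
    where
    m≤1 : ∀ e → m e ≤ 1ℚ
    m≤1 e = let v , v∈e = edgeNonempty H e in
      ≤-trans (term≤load m≥0 v∈e) (≤-reflexive (trans (sym (load≡combination m v)) (load≡1 v)))

  system : Fin (nE H) → Row (nV H)
  system e = restrict (incidence e)

  perturbation⇒solution : Perturbable H → Solution system
  perturbation⇒solution (p , sumFin≡0 , p<0) = tail p , λ e → <-respˡ-≡ (p[e]≡ e) (p<0 e)
    where
    p[e]≡ : ∀ e → sumOver (edge H e) p ≡ system e · tail p
    p[e]≡ e = trans (sumOver≡incidence-· e p)
                    (sym (restrict-·-sum≡0 (incidence e) p (trans (sym (sumFin≡∑ (V H) p)) sumFin≡0)))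

  solution⇒perturbation : Solution system → Perturbable H
  solution⇒perturbation (q , q<0) = p , trans (sumFin≡∑ (V H) p) ∑p≡0 , λ e → <-respˡ-≡ (p[e]≡ e) (q<0 e)
    where
    p : Row (V H)
    p = - sum q Vec.∷ q
    ∑p≡0 : sum p ≡ 0ℚ
    ∑p≡0 = +-inverseˡ (sum q)
    p[e]≡ : ∀ e → system e · q ≡ sumOver (edge H e) p
    p[e]≡ e = trans (restrict-·-sum≡0 (incidence e) p ∑p≡0) (sym (sumOver≡incidence-· e p))

  pfm⇒certificate : HasPerfectFractionalMatching H → Certificate system
  pfm⇒certificate (m , ((m∈[0,1] , _) , load≡1)) =
    let e , me*χ>0 = ∃-positive-term (λ e → m e * incidence e zero)
                                     (<-respʳ-≡ (sym (L≡1 zero)) (positive⁻¹ 1ℚ))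
    in m , (proj₁ ∘ m∈[0,1] , e , positive-factor (m e) _ me*χ>0) , vanishes
    where
    L≡1 : ∀ v → combination incidence m v ≡ 1ℚ
    L≡1 v = trans (sym (load≡combination m v)) (load≡1 v)
    vanishes : ∀ k → combination system m k ≡ 0ℚ
    vanishes k = trans (restrict-combination incidence m k)
                       (trans (cong₂ _-_ (L≡1 (suc k)) (L≡1 zero)) (+-inverseʳ 1ℚ))
    positive-factor : ∀ x b → 0ℚ < x * indicator b → 0ℚ < x
    positive-factor x true  0<x*1 = <-respʳ-≡ (*-identityʳ x) 0<x*1
    positive-factor x false 0<x*0 = contradiction (<-respʳ-≡ (*-zeroʳ x) 0<x*0) (<-irrefl refl)

  certificate⇒pfm : Certificate system → HasPerfectFractionalMatching H
  certificate⇒pfm (w , (w≥0 , e , we>0) , vanishes) = matching , perfect-fractional-matching matching≥0 load≡1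
    where
    C : ℚ
    C = combination incidence w zero
    uniform : ∀ v → combination incidence w v ≡ C
    uniform zero    = refl
    uniform (suc k) = p-q≡0⇒p≡q _ _ (trans (sym (restrict-combination incidence w k)) (vanishes k))
    C>0 : 0ℚ < C
    C>0 = let v , v∈e = edgeNonempty H e in
      <-≤-trans we>0 (≤-trans (term≤load w≥0 v∈e) (≤-reflexive (uniform v)))
    C≢0 : NonZero C
    C≢0 = pos⇒nonZero C {{positive C>0}}
    C⁻¹ : ℚ
    C⁻¹ = (1/ C) {{C≢0}}
    matching : Fin (nE H) → ℚ
    matching e = w e * C⁻¹
    matching≥0 : ∀ e → 0ℚ ≤ matching e
    matching≥0 e = ≥0*≥0⇒≥0 (w≥0 e) (<⇒≤ (positive⁻¹ C⁻¹ {{1/pos⇒pos C {{positive C>0}}}}))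
    load≡1 : ∀ v → load H matching v ≡ 1ℚ
    load≡1 v = begin
      load H matching v                ≡⟨ load≡combination matching v ⟩
      combination incidence matching v ≡⟨ combination-*ʳ incidence w C⁻¹ v ⟩
      combination incidence w v * C⁻¹  ≡⟨ cong (_* C⁻¹) (uniform v) ⟩
      C * C⁻¹                          ≡⟨ *-inverseʳ C {{C≢0}} ⟩
      1ℚ                               ∎
      where open ≡-Reasoning

theorem2p2 : (H : Hypergraph) → Perturbable H ⇔ (¬ HasPerfectFractionalMatching H)
theorem2p2 H = mk⇔
  (λ perturbable pfm →
     solution-certificate-exclusive (system H) (perturbation⇒solution H perturbable) (pfm⇒certificate H pfm))
  (λ no-pfm →
     [ solution⇒perturbation H , ⊥-elim ∘ no-pfm ∘ certificate⇒pfm H ]′ (gordan (nV H) (system H)))
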